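{- For each positive integer $n$: (i) $f_n(n) = f_{n-1}(n) = n!$ and $f_0(n) = 1$; (ii) if $n \ge 2$, then $f_{n-2}(n) = n!/2$; (iii) $f_1(n) = n$.
   Context: Let $S_n$ denote the set of permutations of $\{1,\ldots,n\}$, written in one-line notation as strings $\sigma(1)\sigma(2)\cdots\sigma(n)$. For $\sigma \in S_n$ and $A \subseteq \{1,\ldots,n\}$, $\sigma - A$ denotes the string obtained from $\sigma$ by deleting all symbols in $A$ (and contracting). The Ulam distance is $d_U(\alpha,\beta) = \min\{|A| : \alpha - A = \beta - A\}$ for $\alpha,\beta \in S_n$. For integers $k \ge 0$ and $n \ge 1$, $f_k(n)$ denotes the maximum size of a set $\mathcal{F} \subseteq S_n$ such that $d_U(\alpha,\beta) \leq k$ for all $\alpha,\beta \in \mathcal{F}$. -}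

module Defs where

open import Data.Nat using (ℕ; _≤_)
open import Data.Bool using (not)
open import Data.Fin using (Fin)
open import Data.Fin.Subset using (Subset; ∣_∣)
open import Data.Vec using (lookup)
open import Data.List using (List; length; filterᵇ; allFin)
open import Data.List.Relation.Unary.All using (All)
open import Data.List.Relation.Unary.AllPairs using (AllPairs)
open import Data.List.Relation.Unary.Unique.Propositional using (Unique)
open import Data.List.Relation.Binary.Permutation.Propositional using (_↭_)
open import Data.Product using (∃; _×_)
open import Relation.Binary.PropositionalEquality using (_≡_)

-- A permutation of the symbol set Fin n (standing for {1,…,n}) written in
-- one-line notation: a word over Fin n that is a rearrangement of 0,1,…,n-1.
IsPerm : (n : ℕ) → List (Fin n) → Set
IsPerm n σ = σ ↭ allFin n

_-_ : {n : ℕ} → List (Fin n) → Subset n → List (Fin n)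
σ - A = filterᵇ (λ x → not (lookup A x)) σ

-- d_U(α,β) ≤ k, where d_U(α,β) = min { |A| : α - A = β - A }.
-- (min ≤ k iff some admissible A has |A| ≤ k.)
UlamWithin : {n : ℕ} → ℕ → List (Fin n) → List (Fin n) → Set
UlamWithin {n} k α β = ∃ λ (A : Subset n) → ∣ A ∣ ≤ k × (α - A ≡ β - A)

IsKFamily : (k n : ℕ) → List (List (Fin n)) → Set
IsKFamily k n ℱ = All (IsPerm n) ℱ × Unique ℱ × AllPairs (UlamWithin k) ℱ

fIs : (k n m : ℕ) → Set
fIs k n m =
  (∃ λ ℱ → IsKFamily k n ℱ × length ℱ ≡ m) ×
  (∀ ℱ → IsKFamily k n ℱ → length ℱ ≤ m)

-- The upper bounds rest on one observation: if α - A ≡ β - A then α and β order every pair of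
-- symbols outside A in the same way, whereas a permutation and its reverse order every pair
-- oppositely.
-- (i) Deleting all symbols but one identifies any two permutations, while d_U(α, β) = 0 forces
--     α = β.
-- (ii) When |A| ≤ n - 2 some pair survives the deletion, so a family never contains a permutation
--     together with its reverse and has at most n!/2 members.  The permutations placing a before b
--     all agree after deleting every other symbol, and they are exactly half of Sₙ.
-- (iii) The n ways of inserting a symbol into a fixed word form a family.  Conversely, call a pair
--     unsettled if two members of a family order it differently.  With single deletions, two
--     disjoint pairs cannot both be unsettled, so the unsettled pairs form a star or lie inside a
--     triangle.  For a star with centre c, all members agree after deleting c and are insertions
--     of c into one word.  For a triangle, members are determined by their restrictions to its
--     three vertices, no two of which are reverse to each other, leaving at most 3!/2 ≤ n members.

module Submission where

open import Defs
open import Data.Nat using (ℕ; zero; suc; _+_; _*_; _≤_; _∸_; _/_; z≤n; s≤s)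
open import Data.Nat.Base using (_!)
open import Data.Nat.Properties
  using (≤-refl; ≤-trans; ≤-reflexive; ≤-antisym; 1+n≰n; *-comm; +-suc; +-identityʳ; +-cancelʳ-≤; +-monoʳ-≤;
         *-cancelʳ-≤; ∸-monoʳ-≤; m∸n≤m; m∸[m∸n]≡n; module ≤-Reasoning)
open import Data.Nat.DivMod using (m*n/n≡m; /-monoˡ-≤)
open import Data.Bool using (Bool; true; false; not; T)
open import Data.Bool.Properties using (not-involutive; T-≡)
open import Data.Unit using (tt)
open import Data.Empty using (⊥; ⊥-elim)
open import Data.Fin using (Fin; zero; suc; _≟_)
open import Data.Fin.Properties using (suc-injective; all?; ¬∀⟶∃¬)
open import Data.Fin.Subset using (Subset; ∣_∣; ∁; _∪_; ⁅_⁆)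
  renaming (⊥ to ∅; _∈_ to _∈ₛ_; _∉_ to _∉ₛ_; _⊆_ to _⊆ₛ_)
open import Data.Fin.Subset.Properties
  using (x∈p⇒∣p-x∣<∣p∣; x∈p∧x≢y⇒x∈p-y; x∈⁅x⁆; x∈⁅y⁆⇒x≡y; x∈p∪q⁻; x∈p∪q⁺; x∉p⇒x∈∁p; x∈∁p⇒x∉p;
         x≢y⇒x∉⁅y⁆; x∉⁅y⁆⇒x≢y; ∉⊥; ∣∁p∣≡n∸∣p∣; ∣⊥∣≡0; ∣⁅x⁆∣≡1; ∣p∣≤n)
  renaming (_∈?_ to _∈ₛ?_)
open import Data.Vec using (_∷_; lookup; here; there)
open import Data.Vec.Properties using (lookup-map; []=⇒lookup; lookup⇒[]=)
open import Data.List using (List; []; _∷_; _++_; [_]; length; map; filter; filterᵇ; concatMap; reverse; allFin)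
open import Data.List.Properties
  using (length-++; length-++-sucʳ; length-map; length-tabulate; filter-++; filter-≐; filter-all; filter-accept;
         filter-reject; reverse-injective; unfold-reverse; reverse-++; ∷-injectiveˡ; ∷-injectiveʳ; ≡-dec)
open import Data.List.Membership.Propositional using (_∈_; _∉_; find; lose)
open import Data.List.Membership.Propositional.Properties
  using (∈-∃++; ∈-++⁺ˡ; ∈-++⁺ʳ; ∈-++⁻; ∈-map⁺; ∈-map⁻; ∈-filter⁻; ∈-filter⁺; ∈-concatMap⁺; ∈-concatMap⁻; ∈-allFin)
open import Data.List.Relation.Unary.Any using (here; there)
open import Data.List.Relation.Unary.All as All using (All; []; _∷_)
open import Data.List.Relation.Unary.All.Properties using (¬All⇒Any¬)
open import Data.List.Relation.Unary.AllPairs using (AllPairs; []; _∷_)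
open import Data.List.Relation.Unary.Unique.Propositional using (Unique)
import Data.List.Relation.Unary.Unique.Propositional.Properties as Unique
open import Data.List.Relation.Binary.Permutation.Propositional
  using (_↭_; ↭-refl; ↭-sym; ↭-trans; prep; ↭⇒↭ₛ) renaming (swap to ↭-swap)
open import Data.List.Relation.Binary.Permutation.Propositional.Properties
  using (∈-resp-↭; ↭-length; shift; drop-∷; ↭-empty-inv; ↭-reverse; filter-↭)
open import Data.List.Relation.Binary.Permutation.Setoid.Properties using (Unique-resp-↭)
open import Data.Product using (∃; ∃₂; _×_; _,_; proj₁; proj₂)
open import Data.Sum as Sum using (_⊎_; inj₁; inj₂; fromInj₂; swap)
open import Function using (id; _∘_; _∘′_; case_of_)
open import Function.Bundles using (Equivalence)
open import Relation.Nullary using (¬_; ¬?; Dec; does; yes; no; contradiction)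
open import Relation.Nullary.Decidable using (T?; _⊎-dec_; _×-dec_; decidable-stable)
open import Relation.Binary.Definitions using (DecidableEquality; Symmetric)
open import Relation.Binary.PropositionalEquality
  using (_≡_; _≢_; refl; sym; trans; cong; cong₂; subst; subst₂; setoid; module ≡-Reasoning)

-- Lists without repetition

module _ {A : Set} where

  Unique⇒length≤ : ∀ {xs ys : List A} → Unique xs → (∀ {z} → z ∈ xs → z ∈ ys) → length xs ≤ length ys
  Unique⇒length≤ {[]} _ _ = z≤n
  Unique⇒length≤ {x ∷ xs} {ys} (x∉xs ∷ xs!) xs⊆ys with ∈-∃++ (xs⊆ys (here refl))
  ... | us , vs , refl = begin
    suc (length xs)          ≤⟨ s≤s (Unique⇒length≤ xs! xs⊆us++vs) ⟩
    suc (length (us ++ vs))  ≡⟨ length-++-sucʳ us x vs ⟨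
    length (us ++ x ∷ vs)    ∎
    where
    open ≤-Reasoning
    xs⊆us++vs : ∀ {z} → z ∈ xs → z ∈ us ++ vs
    xs⊆us++vs z∈xs with ∈-++⁻ us (xs⊆ys (there z∈xs))
    ... | inj₁ z∈us = ∈-++⁺ˡ z∈us
    ... | inj₂ (here z≡x) = contradiction (sym z≡x) (All.lookup x∉xs z∈xs)
    ... | inj₂ (there z∈vs) = ∈-++⁺ʳ us z∈vs

  Unique-map⁺-injectiveOn : ∀ {B : Set} (f : A → B) {xs} → Unique xs →
    (∀ {x y} → x ∈ xs → y ∈ xs → f x ≡ f y → x ≡ y) → Unique (map f xs)
  Unique-map⁺-injectiveOn f {[]} _ _ = []
  Unique-map⁺-injectiveOn f {x ∷ xs} (x∉xs ∷ xs!) f-inj =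
    All.tabulate fx≢ ∷ Unique-map⁺-injectiveOn f xs! (λ p q → f-inj (there p) (there q))
    where
    fx≢ : ∀ {z} → z ∈ map f xs → f x ≢ z
    fx≢ z∈ fx≡z with ∈-map⁻ f z∈
    ... | y , y∈xs , refl = All.lookup x∉xs y∈xs (f-inj (here refl) (there y∈xs) fx≡z)

  AllPairs-tabulate : ∀ {R : A → A → Set} xs → (∀ {x y} → x ∈ xs → y ∈ xs → R x y) → AllPairs R xs
  AllPairs-tabulate [] _ = []
  AllPairs-tabulate (x ∷ xs) R-all =
    All.tabulate (R-all (here refl) ∘ there) ∷ AllPairs-tabulate xs (λ p q → R-all (there p) (there q))

  AllPairs-lookup : ∀ {R : A → A → Set} {xs} → Symmetric R → AllPairs R xs →
    ∀ {x y} → x ∈ xs → y ∈ xs → x ≡ y ⊎ R x y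
  AllPairs-lookup sym-R (_ ∷ _) (here refl) (here refl) = inj₁ refl
  AllPairs-lookup sym-R (Rx ∷ _) (here refl) (there q) = inj₂ (All.lookup Rx q)
  AllPairs-lookup sym-R (Rx ∷ _) (there p) (here refl) = inj₂ (sym-R (All.lookup Rx p))
  AllPairs-lookup sym-R (_ ∷ Rxs) (there p) (there q) = AllPairs-lookup sym-R Rxs p q

  Unique-singleton : ∀ {y : A} {l} → Unique l → (∀ {z} → z ∈ l → z ≡ y) → y ∈ l → l ≡ [ y ]
  Unique-singleton {l = q ∷ []} _ all≡y _ = cong [_] (all≡y (here refl))
  Unique-singleton {l = q ∷ r ∷ _} ((q≢r ∷ _) ∷ _) all≡y _ =
    contradiction (trans (all≡y (here refl)) (sym (all≡y (there (here refl))))) q≢r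

  ∷-pair-tail : ∀ {p q : A} {l} → Unique (p ∷ l) → (∀ {z} → z ∈ p ∷ l → z ≡ p ⊎ z ≡ q) → q ≢ p → q ∈ p ∷ l →
    l ≡ [ q ]
  ∷-pair-tail _ _ q≢p (here q≡p) = contradiction q≡p q≢p
  ∷-pair-tail {p} {q} {l} (p∉l ∷ l!) ⊆pq _ (there q∈l) = Unique-singleton l! only-q q∈l
    where
    only-q : ∀ {z} → z ∈ l → z ≡ q
    only-q z∈l = fromInj₂ (λ z≡p → contradiction (sym z≡p) (All.lookup p∉l z∈l)) (⊆pq (there z∈l))

  Unique-pair : ∀ {x y : A} {l} → x ≢ y → Unique l → (∀ {z} → z ∈ l → z ≡ x ⊎ z ≡ y) → x ∈ l → y ∈ l →
    l ≡ x ∷ y ∷ [] ⊎ l ≡ y ∷ x ∷ []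
  Unique-pair {l = p ∷ l} x≢y l! l⊆ x∈ y∈ with l⊆ (here refl)
  ... | inj₁ refl = inj₁ (cong (p ∷_) (∷-pair-tail l! l⊆ (x≢y ∘ sym) y∈))
  ... | inj₂ refl = inj₂ (cong (p ∷_) (∷-pair-tail l! (swap ∘ l⊆) x≢y x∈))

  filterᵇ-cong : ∀ {p q : A → Bool} → (∀ x → p x ≡ q x) → ∀ xs → filterᵇ p xs ≡ filterᵇ q xs
  filterᵇ-cong p≡q = filter-≐ _ _ ((λ {x} → subst T (p≡q x)) , (λ {x} → subst T (sym (p≡q x))))

  filterᵇ-filterᵇ : ∀ (p q : A → Bool) → (∀ x → p x ≡ true → q x ≡ true) →
    ∀ xs → filterᵇ p (filterᵇ q xs) ≡ filterᵇ p xs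
  filterᵇ-filterᵇ p q p⇒q [] = refl
  filterᵇ-filterᵇ p q p⇒q (x ∷ xs) with q x in qx
  ... | true with p x
  ...   | true  = cong (x ∷_) (filterᵇ-filterᵇ p q p⇒q xs)
  ...   | false = filterᵇ-filterᵇ p q p⇒q xs
  filterᵇ-filterᵇ p q p⇒q (x ∷ xs) | false with p x in px
  ...   | false = filterᵇ-filterᵇ p q p⇒q xs
  ...   | true with () ← trans (sym (p⇒q x px)) qx

  filterᵇ-reverse : ∀ (p : A → Bool) xs → filterᵇ p (reverse xs) ≡ reverse (filterᵇ p xs)
  filterᵇ-reverse p [] = refl
  filterᵇ-reverse p (x ∷ xs) = begin
    filterᵇ p (reverse (x ∷ xs))                         ≡⟨ cong (filterᵇ p) (unfold-reverse x xs) ⟩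
    filterᵇ p (reverse xs ++ [ x ])                      ≡⟨ filter-++ (T? ∘ p) (reverse xs) [ x ] ⟩
    filterᵇ p (reverse xs) ++ filterᵇ p [ x ]            ≡⟨ cong₂ _++_ (filterᵇ-reverse p xs) singleton-reverse ⟩
    reverse (filterᵇ p xs) ++ reverse (filterᵇ p [ x ])  ≡⟨ reverse-++ (filterᵇ p [ x ]) (filterᵇ p xs) ⟨
    reverse (filterᵇ p [ x ] ++ filterᵇ p xs)            ≡⟨ cong reverse (filter-++ (T? ∘ p) [ x ] xs) ⟨
    reverse (filterᵇ p (x ∷ xs))                         ∎
    where
    open ≡-Reasoning
    singleton-reverse : filterᵇ p [ x ] ≡ reverse (filterᵇ p [ x ])
    singleton-reverse with p x
    ... | true  = refl
    ... | false = refl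

  length-filter-+-¬ : ∀ {P : A → Set} (P? : ∀ x → Dec (P x)) xs →
    length (filter P? xs) + length (filter (λ x → ¬? (P? x)) xs) ≡ length xs
  length-filter-+-¬ P? [] = refl
  length-filter-+-¬ P? (x ∷ xs) with does (P? x)
  ... | true  = cong suc (length-filter-+-¬ P? xs)
  ... | false = trans (+-suc _ _) (cong suc (length-filter-+-¬ P? xs))

-- Insertions and permutations

module _ {A : Set} where

  insertions : A → List A → List (List A)
  insertions x [] = [ [ x ] ]
  insertions x (y ∷ ys) = (x ∷ y ∷ ys) ∷ map (y ∷_) (insertions x ys)

  length-insertions : ∀ x ys → length (insertions x ys) ≡ suc (length ys)
  length-insertions x [] = refl
  length-insertions x (y ∷ ys) = cong suc (trans (length-map (y ∷_) (insertions x ys)) (length-insertions x ys))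

  ∈-insertions⇒↭ : ∀ {x σ} ys → σ ∈ insertions x ys → σ ↭ x ∷ ys
  ∈-insertions⇒↭ [] (here refl) = ↭-refl
  ∈-insertions⇒↭ (y ∷ ys) (here refl) = ↭-refl
  ∈-insertions⇒↭ (y ∷ ys) (there σ∈) with ∈-map⁻ (y ∷_) σ∈
  ... | τ , τ∈ , refl = ↭-trans (prep y (∈-insertions⇒↭ ys τ∈)) (↭-swap y _ ↭-refl)

  ++-∈-insertions : ∀ x us vs → us ++ x ∷ vs ∈ insertions x (us ++ vs)
  ++-∈-insertions x [] [] = here refl
  ++-∈-insertions x [] (v ∷ vs) = here refl
  ++-∈-insertions x (u ∷ us) vs = there (∈-map⁺ (u ∷_) (++-∈-insertions x us vs))

  insertions-Unique : ∀ {x} ys → x ∉ ys → Unique (insertions x ys)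
  insertions-Unique [] _ = [] ∷ []
  insertions-Unique {x} (y ∷ ys) x∉ =
    All.tabulate head≢ ∷ Unique.map⁺ ∷-injectiveʳ (insertions-Unique ys (x∉ ∘ there))
    where
    head≢ : ∀ {σ} → σ ∈ map (y ∷_) (insertions x ys) → x ∷ y ∷ ys ≢ σ
    head≢ σ∈ eq with ∈-map⁻ (y ∷_) σ∈
    ... | τ , _ , refl = x∉ (here (∷-injectiveˡ eq))

  concatMap-Unique : ∀ {B : Set} (f : B → List A) {ws} → Unique ws → (∀ {w} → w ∈ ws → Unique (f w)) →
    (∀ {w w′ σ} → w ∈ ws → w′ ∈ ws → σ ∈ f w → σ ∈ f w′ → w ≡ w′) → Unique (concatMap f ws)
  concatMap-Unique f {[]} _ _ _ = []
  concatMap-Unique f {w ∷ ws} (w∉ws ∷ ws!) f! f-disjoint =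
    Unique.++⁺ (f! (here refl))
      (concatMap-Unique f ws! (f! ∘ there) (λ p q → f-disjoint (there p) (there q))) disjoint
    where
    disjoint : ∀ {σ} → ¬ (σ ∈ f w × σ ∈ concatMap f ws)
    disjoint (σ∈fw , σ∈rest) with find (∈-concatMap⁻ f σ∈rest)
    ... | w′ , w′∈ , σ∈fw′ = All.lookup w∉ws w′∈ (f-disjoint (here refl) (there w′∈) σ∈fw σ∈fw′)

  permutations : List A → List (List A)
  permutations [] = [ [] ]
  permutations (x ∷ xs) = concatMap (insertions x) (permutations xs)

  permutations-↭ : ∀ xs {σ} → σ ∈ permutations xs → σ ↭ xs
  permutations-↭ [] (here refl) = ↭-refl
  permutations-↭ (x ∷ xs) σ∈ with find (∈-concatMap⁻ (insertions x) σ∈)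
  ... | w , w∈ , σ∈ins = ↭-trans (∈-insertions⇒↭ w σ∈ins) (prep x (permutations-↭ xs w∈))

  ↭⇒∈-permutations : ∀ xs {σ} → σ ↭ xs → σ ∈ permutations xs
  ↭⇒∈-permutations [] σ↭[] rewrite ↭-empty-inv σ↭[] = here refl
  ↭⇒∈-permutations (x ∷ xs) σ↭ with ∈-∃++ (∈-resp-↭ (↭-sym σ↭) (here refl))
  ... | us , vs , refl = ∈-concatMap⁺ (insertions x) (lose us++vs∈ (++-∈-insertions x us vs))
    where
    us++vs∈ : us ++ vs ∈ permutations xs
    us++vs∈ = ↭⇒∈-permutations xs (drop-∷ (↭-trans (↭-sym (shift x us vs)) σ↭))

  length-permutations : ∀ xs → length (permutations xs) ≡ length xs !
  length-permutations [] = refl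
  length-permutations (x ∷ xs) = begin
    length (concatMap (insertions x) (permutations xs))  ≡⟨ length-concatMap (permutations xs) ins-length ⟩
    length (permutations xs) * suc (length xs)          ≡⟨ cong (_* suc (length xs)) (length-permutations xs) ⟩
    length xs ! * suc (length xs)                       ≡⟨ *-comm (length xs !) (suc (length xs)) ⟩
    suc (length xs) !                                   ∎
    where
    open ≡-Reasoning
    ins-length : ∀ {w} → w ∈ permutations xs → length (insertions x w) ≡ suc (length xs)
    ins-length {w} w∈ = trans (length-insertions x w) (cong suc (↭-length (permutations-↭ xs w∈)))
    length-concatMap : ∀ ws {m} → (∀ {w} → w ∈ ws → length (insertions x w) ≡ m) →
      length (concatMap (insertions x) ws) ≡ length ws * m
    length-concatMap [] _ = refl
    length-concatMap (w ∷ ws) same = trans (length-++ (insertions x w))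
      (cong₂ _+_ (same (here refl)) (length-concatMap ws (same ∘ there)))

module _ {A : Set} (_≟_ : DecidableEquality A) where

  _≢?_ : ∀ (z x : A) → Dec (z ≢ x)
  z ≢? x = ¬? (z ≟ x)

  remove : A → List A → List A
  remove x = filter (_≢? x)

  remove-∉ : ∀ {x} ys → x ∉ ys → remove x ys ≡ ys
  remove-∉ {x} ys x∉ys = filter-all (_≢? x) (All.tabulate (λ z∈ z≡x → x∉ys (subst (_∈ ys) z≡x z∈)))

  remove-insertions : ∀ {x σ} ys → x ∉ ys → σ ∈ insertions x ys → remove x σ ≡ ys
  remove-insertions {x} [] _ (here refl) = filter-reject (_≢? x) (λ x≢x → x≢x refl)
  remove-insertions {x} (y ∷ ys) x∉ (here refl) =
    trans (filter-reject (_≢? x) (λ x≢x → x≢x refl)) (remove-∉ (y ∷ ys) x∉)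
  remove-insertions {x} (y ∷ ys) x∉ (there σ∈) with ∈-map⁻ (y ∷_) σ∈
  ... | τ , τ∈ , refl = trans (filter-accept (_≢? x) (λ y≡x → x∉ (here (sym y≡x))))
                             (cong (y ∷_) (remove-insertions ys (x∉ ∘ there) τ∈))

  ∈-insertions-remove : ∀ {x σ} → Unique σ → x ∈ σ → σ ∈ insertions x (remove x σ)
  ∈-insertions-remove {x} {x ∷ σ} (x∉σ ∷ _) (here refl)
    rewrite filter-reject (_≢? x) {xs = σ} (λ x≢x → x≢x refl)
          | remove-∉ σ (λ x∈σ → All.lookup x∉σ x∈σ refl)
    = ++-∈-insertions x [] σ
  ∈-insertions-remove {x} {c ∷ σ} (c∉σ ∷ σ!) (there x∈σ)
    rewrite filter-accept (_≢? x) {xs = σ} (All.lookup c∉σ x∈σ)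
    = there (∈-map⁺ (c ∷_) (∈-insertions-remove σ! x∈σ))

  permutations-Unique : ∀ {xs} → Unique xs → Unique (permutations xs)
  permutations-Unique {[]} _ = [] ∷ []
  permutations-Unique {x ∷ xs} (x∉xs ∷ xs!) =
    concatMap-Unique (insertions x) (permutations-Unique xs!) (λ w∈ → insertions-Unique _ (x∉ w∈))
      (λ w∈ w′∈ σ∈ σ∈′ → trans (sym (remove-insertions _ (x∉ w∈) σ∈)) (remove-insertions _ (x∉ w′∈) σ∈′))
    where
    x∉ : ∀ {w} → w ∈ permutations xs → x ∉ w
    x∉ w∈ x∈w = All.lookup x∉xs (∈-resp-↭ (permutations-↭ xs w∈) x∈w) refl

m*2≡m+m : ∀ m → m * 2 ≡ m + m
m*2≡m+m m = trans (*-comm m 2) (cong (m +_) (+-identityʳ m))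

m*2≤m+n⇒n*2≤m+n⇒m*2≡m+n : ∀ m n → m * 2 ≤ m + n → n * 2 ≤ m + n → m * 2 ≡ m + n
m*2≤m+n⇒n*2≤m+n⇒m*2≡m+n m n m*2≤ n*2≤ = ≤-antisym m*2≤ (begin
  m + n  ≤⟨ +-monoʳ-≤ m (+-cancelʳ-≤ n n m (≤-trans (≤-reflexive (sym (m*2≡m+m n))) n*2≤)) ⟩
  m + m  ≡⟨ m*2≡m+m m ⟨
  m * 2  ∎)
  where open ≤-Reasoning

module _ {A : Set} where

  Unique⇒length≤! : ∀ {xs : List A} {ℱ} → Unique ℱ → All (_↭ xs) ℱ → length ℱ ≤ length xs !
  Unique⇒length≤! {xs} ℱ! perms = ≤-trans (Unique⇒length≤ ℱ! (↭⇒∈-permutations xs ∘ All.lookup perms))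
                                             (≤-reflexive (length-permutations xs))

  reverseFree⇒length*2≤! : ∀ {xs : List A} {ℱ} → Unique ℱ → All (_↭ xs) ℱ →
    (∀ {α β} → α ∈ ℱ → β ∈ ℱ → α ≢ reverse β) → length ℱ * 2 ≤ length xs !
  reverseFree⇒length*2≤! {xs} {ℱ} ℱ! perms reverseFree = begin
    length ℱ * 2                       ≡⟨ m*2≡m+m (length ℱ) ⟩
    length ℱ + length ℱ                ≡⟨ cong (length ℱ +_) (length-map reverse ℱ) ⟨
    length ℱ + length (map reverse ℱ)  ≡⟨ length-++ ℱ ⟨
    length (ℱ ++ map reverse ℱ)        ≤⟨ Unique⇒length≤! ℱ+rev! (All.tabulate perm) ⟩
    length xs !                        ∎
    where
    open ≤-Reasoning
    ℱ+rev! : Unique (ℱ ++ map reverse ℱ)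
    ℱ+rev! = Unique.++⁺ ℱ! (Unique.map⁺ reverse-injective ℱ!) disjoint
      where
      disjoint : ∀ {σ} → ¬ (σ ∈ ℱ × σ ∈ map reverse ℱ)
      disjoint (σ∈ℱ , σ∈rev) with ∈-map⁻ reverse σ∈rev
      ... | β , β∈ℱ , σ≡ = reverseFree σ∈ℱ β∈ℱ σ≡
    perm : ∀ {σ} → σ ∈ ℱ ++ map reverse ℱ → σ ↭ xs
    perm σ∈ with ∈-++⁻ ℱ σ∈
    ... | inj₁ σ∈ℱ = All.lookup perms σ∈ℱ
    ... | inj₂ σ∈rev with ∈-map⁻ reverse σ∈rev
    ...   | β , β∈ℱ , refl = ↭-trans (↭-reverse β) (All.lookup perms β∈ℱ)

-- Permutations of Fin n and their restrictions to subsets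

module _ {n : ℕ} where

  IsPerm⇒Unique : ∀ {σ} → IsPerm n σ → Unique σ
  IsPerm⇒Unique σ↭ = Unique-resp-↭ (setoid (Fin n)) (↭⇒↭ₛ (↭-sym σ↭)) (Unique.allFin⁺ n)

  IsPerm⇒∈ : ∀ {σ} → IsPerm n σ → ∀ x → x ∈ σ
  IsPerm⇒∈ σ↭ x = ∈-resp-↭ (↭-sym σ↭) (∈-allFin x)

  IsPerm⇒length : ∀ {σ} → IsPerm n σ → length σ ≡ n
  IsPerm⇒length σ↭ = trans (↭-length σ↭) (length-tabulate {n = n} id)

allPerms : (n : ℕ) → List (List (Fin n))
allPerms n = permutations (allFin n)

module _ {n : ℕ} where

  ∈-allPerms⁻ : ∀ {σ} → σ ∈ allPerms n → IsPerm n σ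
  ∈-allPerms⁻ = permutations-↭ (allFin n)

  allPerms-Unique : Unique (allPerms n)
  allPerms-Unique = permutations-Unique _≟_ (Unique.allFin⁺ n)

  length-allPerms : length (allPerms n) ≡ n !
  length-allPerms = trans (length-permutations (allFin n)) (cong _! (length-tabulate {n = n} id))

  length≤n! : ∀ {ℱ} → All (IsPerm n) ℱ → Unique ℱ → length ℱ ≤ n !
  length≤n! perms ℱ! = ≤-trans (Unique⇒length≤! ℱ! perms) (≤-reflexive (cong _! (length-tabulate {n = n} id)))

1≤∣p∣ : ∀ {n} {p : Subset n} {x} → x ∈ₛ p → 1 ≤ ∣ p ∣
1≤∣p∣ x∈p = ≤-trans (s≤s z≤n) (x∈p⇒∣p-x∣<∣p∣ x∈p)

2≤∣p∣ : ∀ {n} {p : Subset n} {x y} → x ≢ y → x ∈ₛ p → y ∈ₛ p → 2 ≤ ∣ p ∣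
2≤∣p∣ x≢y x∈p y∈p = ≤-trans (s≤s (1≤∣p∣ (x∈p∧x≢y⇒x∈p-y y∈p (x≢y ∘′ sym)))) (x∈p⇒∣p-x∣<∣p∣ x∈p)

∣p∣≤0⇒∉ : ∀ {n} {p : Subset n} {x} → ∣ p ∣ ≤ 0 → x ∉ₛ p
∣p∣≤0⇒∉ ∣p∣≤0 x∈p = 1+n≰n (≤-trans (1≤∣p∣ x∈p) ∣p∣≤0)

∣p∣≤1⇒∉ : ∀ {n} {p : Subset n} {x y} → ∣ p ∣ ≤ 1 → x ∈ₛ p → y ≢ x → y ∉ₛ p
∣p∣≤1⇒∉ ∣p∣≤1 x∈p y≢x y∈p = 1+n≰n (≤-trans (2≤∣p∣ y≢x y∈p x∈p) ∣p∣≤1)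

1≤∣p∣⇒∈ : ∀ {n} (p : Subset n) → 1 ≤ ∣ p ∣ → ∃ (_∈ₛ p)
1≤∣p∣⇒∈ (true ∷ p) _ = zero , here
1≤∣p∣⇒∈ (false ∷ p) 1≤∣p∣ with x , x∈p ← 1≤∣p∣⇒∈ p 1≤∣p∣ = suc x , there x∈p

2≤∣p∣⇒∈ : ∀ {n} (p : Subset n) → 2 ≤ ∣ p ∣ → ∃₂ λ x y → x ≢ y × x ∈ₛ p × y ∈ₛ p
2≤∣p∣⇒∈ (true ∷ p) (s≤s 1≤∣p∣) with y , y∈p ← 1≤∣p∣⇒∈ p 1≤∣p∣ = zero , suc y , (λ ()) , here , there y∈p
2≤∣p∣⇒∈ (false ∷ p) 2≤∣p∣ with x , y , x≢y , x∈p , y∈p ← 2≤∣p∣⇒∈ p 2≤∣p∣ =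
  suc x , suc y , x≢y ∘′ suc-injective , there x∈p , there y∈p

module _ {n : ℕ} where

  infixl 6 _↾_

  _↾_ : List (Fin n) → Subset n → List (Fin n)
  σ ↾ S = filterᵇ (lookup S) σ

  ∉⇒lookup : ∀ {S : Subset n} {x} → x ∉ₛ S → lookup S x ≡ false
  ∉⇒lookup {S} {x} x∉S with lookup S x in Sx
  ... | true  = contradiction (lookup⇒[]= x S Sx) x∉S
  ... | false = refl

  ↾-accept : ∀ {S : Subset n} {x} σ → x ∈ₛ S → (x ∷ σ) ↾ S ≡ x ∷ σ ↾ S
  ↾-accept σ x∈S rewrite []=⇒lookup x∈S = refl

  ↾-reject : ∀ {S : Subset n} {x} σ → x ∉ₛ S → (x ∷ σ) ↾ S ≡ σ ↾ S
  ↾-reject σ x∉S rewrite ∉⇒lookup x∉S = refl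

  ∈-↾⁻ : ∀ {S : Subset n} {x} σ → x ∈ σ ↾ S → x ∈ σ × x ∈ₛ S
  ∈-↾⁻ {S} {x} σ x∈σ↾S with x∈σ , Sx ← ∈-filter⁻ (λ z → T? (lookup S z)) {xs = σ} x∈σ↾S =
    x∈σ , lookup⇒[]= x S (Equivalence.to T-≡ Sx)

  ∈-↾⁺ : ∀ {S : Subset n} {x σ} → x ∈ σ → x ∈ₛ S → x ∈ σ ↾ S
  ∈-↾⁺ {S} x∈σ x∈S = ∈-filter⁺ (λ z → T? (lookup S z)) x∈σ (Equivalence.from T-≡ ([]=⇒lookup x∈S))

  ↾-Unique : ∀ {σ} S → Unique σ → Unique (σ ↾ S)
  ↾-Unique S = Unique.filter⁺ (λ z → T? (lookup S z))

  ↾-↾ : ∀ {S U : Subset n} → S ⊆ₛ U → ∀ σ → σ ↾ U ↾ S ≡ σ ↾ S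
  ↾-↾ {S} {U} S⊆U = filterᵇ-filterᵇ (lookup S) (lookup U) (λ x Sx → []=⇒lookup (S⊆U (lookup⇒[]= x S Sx)))

  -≡↾∁ : ∀ σ A → σ - A ≡ σ ↾ ∁ A
  -≡↾∁ σ A = filterᵇ-cong (λ x → sym (lookup-map x not A)) σ

  -∁≡↾ : ∀ σ S → σ - ∁ S ≡ σ ↾ S
  -∁≡↾ σ S = filterᵇ-cong (λ x → trans (cong not (lookup-map x not S)) (not-involutive (lookup S x))) σ

  deletion⇒↾ : ∀ {α β} {A S : Subset n} → α - A ≡ β - A → S ⊆ₛ ∁ A → α ↾ S ≡ β ↾ S
  deletion⇒↾ {α} {β} {A} {S} α-A≡β-A S⊆∁A = begin
    α ↾ S        ≡⟨ ↾-↾ S⊆∁A α ⟨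
    α ↾ ∁ A ↾ S  ≡⟨ cong (_↾ S) (trans (sym (-≡↾∁ α A)) (trans α-A≡β-A (-≡↾∁ β A))) ⟩
    β ↾ ∁ A ↾ S  ≡⟨ ↾-↾ S⊆∁A β ⟩
    β ↾ S        ∎
    where open ≡-Reasoning

  ⟦_⟧ : List (Fin n) → Subset n
  ⟦ [] ⟧ = ∅
  ⟦ x ∷ xs ⟧ = ⁅ x ⁆ ∪ ⟦ xs ⟧

  ∈⟦⟧⁻ : ∀ xs {z} → z ∈ₛ ⟦ xs ⟧ → z ∈ xs
  ∈⟦⟧⁻ [] z∈ = contradiction z∈ ∉⊥
  ∈⟦⟧⁻ (x ∷ xs) z∈ with x∈p∪q⁻ ⁅ x ⁆ ⟦ xs ⟧ z∈
  ... | inj₁ z∈⁅x⁆ = here (x∈⁅y⁆⇒x≡y x z∈⁅x⁆)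
  ... | inj₂ z∈xs = there (∈⟦⟧⁻ xs z∈xs)

  ∈⟦⟧⁺ : ∀ xs {z} → z ∈ xs → z ∈ₛ ⟦ xs ⟧
  ∈⟦⟧⁺ (x ∷ xs) (here refl) = x∈p∪q⁺ (inj₁ (x∈⁅x⁆ x))
  ∈⟦⟧⁺ (x ∷ xs) (there z∈xs) = x∈p∪q⁺ (inj₂ (∈⟦⟧⁺ xs z∈xs))

  ∈-↾⟦⟧⁻ : ∀ σ {xs z} → z ∈ σ ↾ ⟦ xs ⟧ → z ∈ xs
  ∈-↾⟦⟧⁻ σ {xs} z∈ = ∈⟦⟧⁻ xs (proj₂ (∈-↾⁻ σ z∈))

  ∈-↾⟦⟧⁺ : ∀ {σ} xs {z} → IsPerm n σ → z ∈ xs → z ∈ σ ↾ ⟦ xs ⟧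
  ∈-↾⟦⟧⁺ xs {z} σ↭ z∈xs = ∈-↾⁺ (IsPerm⇒∈ σ↭ z) (∈⟦⟧⁺ xs z∈xs)

  ↾-≐ : ∀ {S U : Subset n} → S ⊆ₛ U → U ⊆ₛ S → ∀ σ → σ ↾ S ≡ σ ↾ U
  ↾-≐ {S} {U} S⊆U U⊆S = filter-≐ (λ z → T? (lookup S z)) (λ z → T? (lookup U z)) (along S⊆U , along U⊆S)
    where
    along : ∀ {P Q : Subset n} → P ⊆ₛ Q → ∀ {z} → T (lookup P z) → T (lookup Q z)
    along {P} {Q} P⊆Q {z} Pz =
      Equivalence.from T-≡ ([]=⇒lookup (P⊆Q (lookup⇒[]= z P (Equivalence.to T-≡ Pz))))

  SameOrder : List (Fin n) → List (Fin n) → Fin n → Fin n → Set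
  SameOrder α β x y = α ↾ ⟦ x ∷ y ∷ [] ⟧ ≡ β ↾ ⟦ x ∷ y ∷ [] ⟧

  SameOrder-swap : ∀ {α β x y} → SameOrder α β x y → SameOrder α β y x
  SameOrder-swap {α} {β} {x} {y} α≈β = begin
    α ↾ ⟦ y ∷ x ∷ [] ⟧  ≡⟨ yx≐xy α ⟩
    α ↾ ⟦ x ∷ y ∷ [] ⟧  ≡⟨ α≈β ⟩
    β ↾ ⟦ x ∷ y ∷ [] ⟧  ≡⟨ yx≐xy β ⟨
    β ↾ ⟦ y ∷ x ∷ [] ⟧  ∎
    where
    open ≡-Reasoning
    swapped : ∀ {u v z} → z ∈ₛ ⟦ u ∷ v ∷ [] ⟧ → z ∈ₛ ⟦ v ∷ u ∷ [] ⟧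
    swapped {u} {v} z∈ with ∈⟦⟧⁻ (u ∷ v ∷ []) z∈
    ... | here refl = ∈⟦⟧⁺ (_ ∷ _ ∷ []) (there (here refl))
    ... | there (here refl) = ∈⟦⟧⁺ (_ ∷ _ ∷ []) (here refl)
    yx≐xy : ∀ σ → σ ↾ ⟦ y ∷ x ∷ [] ⟧ ≡ σ ↾ ⟦ x ∷ y ∷ [] ⟧
    yx≐xy = ↾-≐ (swapped {y} {x}) (swapped {x} {y})

  deletion⇒SameOrder : ∀ {α β} {A : Subset n} {x y} → α - A ≡ β - A → x ∉ₛ A → y ∉ₛ A → SameOrder α β x y
  deletion⇒SameOrder {α} {β} {A} {x} {y} α-A≡β-A x∉A y∉A =
    deletion⇒↾ {α} {β} α-A≡β-A (outside ∘′ ∈⟦⟧⁻ (x ∷ y ∷ []))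
    where
    outside : ∀ {z} → z ∈ x ∷ y ∷ [] → z ∈ₛ ∁ A
    outside (here refl) = x∉p⇒x∈∁p x∉A
    outside (there (here refl)) = x∉p⇒x∈∁p y∉A

  ≡-byPairOrders : ∀ {u v} → Unique u → u ↭ v →
    (∀ {a b} → a ∈ u → b ∈ u → a ≢ b → SameOrder u v a b) → u ≡ v
  ≡-byPairOrders {[]} _ u↭v _ = sym (↭-empty-inv (↭-sym u↭v))
  ≡-byPairOrders {a ∷ u} {[]} _ u↭v _ with () ← ∈-resp-↭ u↭v (here refl)
  ≡-byPairOrders {a ∷ u} {b ∷ v} (a∉u ∷ u!) u↭v orders with a ≟ b
  ... | yes refl = cong (a ∷_) (≡-byPairOrders u! (drop-∷ u↭v) orders′)
    where
    orders′ : ∀ {c d} → c ∈ u → d ∈ u → c ≢ d → SameOrder u v c d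
    orders′ {c} {d} c∈u d∈u c≢d = begin
      u ↾ ⟦ c ∷ d ∷ [] ⟧        ≡⟨ ↾-reject u a∉cd ⟨
      (a ∷ u) ↾ ⟦ c ∷ d ∷ [] ⟧  ≡⟨ orders (there c∈u) (there d∈u) c≢d ⟩
      (a ∷ v) ↾ ⟦ c ∷ d ∷ [] ⟧  ≡⟨ ↾-reject v a∉cd ⟩
      v ↾ ⟦ c ∷ d ∷ [] ⟧        ∎
      where
      open ≡-Reasoning
      a∉cd : a ∉ₛ ⟦ c ∷ d ∷ [] ⟧
      a∉cd a∈ with ∈⟦⟧⁻ (c ∷ d ∷ []) a∈
      ... | here a≡c = All.lookup a∉u c∈u a≡c
      ... | there (here a≡d) = All.lookup a∉u d∈u a≡d
  ... | no a≢b = contradiction (∷-injectiveˡ heads) a≢b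
    where
    heads : a ∷ u ↾ ⟦ a ∷ b ∷ [] ⟧ ≡ b ∷ v ↾ ⟦ a ∷ b ∷ [] ⟧
    heads = trans (sym (↾-accept u (∈⟦⟧⁺ (a ∷ b ∷ []) (here refl))))
      (trans (orders (here refl) (∈-resp-↭ (↭-sym u↭v) (here refl)) a≢b)
             (↾-accept v (∈⟦⟧⁺ (a ∷ b ∷ []) (there (here refl)))))

  ↾-singleton : ∀ {σ} → IsPerm n σ → ∀ x → σ ↾ ⁅ x ⁆ ≡ [ x ]
  ↾-singleton {σ} σ↭ x = Unique-singleton (↾-Unique ⁅ x ⁆ (IsPerm⇒Unique σ↭))
    (λ z∈ → x∈⁅y⁆⇒x≡y x (proj₂ (∈-↾⁻ σ z∈))) (∈-↾⁺ (IsPerm⇒∈ σ↭ x) (x∈⁅x⁆ x))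

  ↾-pair : ∀ {σ x y} → Unique σ → x ∈ σ → y ∈ σ → x ≢ y →
    σ ↾ ⟦ x ∷ y ∷ [] ⟧ ≡ x ∷ y ∷ [] ⊎ σ ↾ ⟦ x ∷ y ∷ [] ⟧ ≡ y ∷ x ∷ []
  ↾-pair {σ} {x} {y} σ! x∈σ y∈σ x≢y = Unique-pair x≢y (↾-Unique ⟦ x ∷ y ∷ [] ⟧ σ!) pair⁻
    (∈-↾⁺ x∈σ (∈⟦⟧⁺ (x ∷ y ∷ []) (here refl))) (∈-↾⁺ y∈σ (∈⟦⟧⁺ (x ∷ y ∷ []) (there (here refl))))
    where
    pair⁻ : ∀ {z} → z ∈ σ ↾ ⟦ x ∷ y ∷ [] ⟧ → z ≡ x ⊎ z ≡ y
    pair⁻ z∈ with ∈-↾⟦⟧⁻ σ {x ∷ y ∷ []} z∈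
    ... | here z≡x = inj₁ z≡x
    ... | there (here z≡y) = inj₂ z≡y

  SameOrder⇒≢reverse : ∀ {α β x y} → Unique β → x ∈ β → y ∈ β → x ≢ y → SameOrder α β x y → α ≢ reverse β
  SameOrder⇒≢reverse {β = β} {x} {y} β! x∈β y∈β x≢y α≈β refl =
    reverse-pair≢ (↾-pair β! x∈β y∈β x≢y) (trans (sym (filterᵇ-reverse (lookup ⟦ x ∷ y ∷ [] ⟧) β)) α≈β)
    where
    reverse-pair≢ : ∀ {l} → l ≡ x ∷ y ∷ [] ⊎ l ≡ y ∷ x ∷ [] → reverse l ≢ l
    reverse-pair≢ (inj₁ refl) rev≡ = x≢y (sym (∷-injectiveˡ rev≡))
    reverse-pair≢ (inj₂ refl) rev≡ = x≢y (∷-injectiveˡ rev≡)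

  ⟦⟧-⊆ : ∀ {xs ys} → (∀ {z} → z ∈ xs → z ∈ ys) → ⟦ xs ⟧ ⊆ₛ ⟦ ys ⟧
  ⟦⟧-⊆ {xs} {ys} xs⊆ys z∈ = ∈⟦⟧⁺ ys (xs⊆ys (∈⟦⟧⁻ xs z∈))

  ⟦⟧⊆∁⁅⁆ : ∀ {xs c} → (∀ {z} → z ∈ xs → z ≢ c) → ⟦ xs ⟧ ⊆ₛ ∁ ⁅ c ⁆
  ⟦⟧⊆∁⁅⁆ {xs} avoids-c z∈ = x∉p⇒x∈∁p (x≢y⇒x∉⁅y⁆ (avoids-c (∈⟦⟧⁻ xs z∈)))

  ∈∁⁅⁆⇒≢ : ∀ {z c : Fin n} → z ∈ₛ ∁ ⁅ c ⁆ → z ≢ c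
  ∈∁⁅⁆⇒≢ z∈ = x∉⁅y⁆⇒x≢y (x∈∁p⇒x∉p z∈)

  ↾∁⁅⁆≡remove : ∀ σ x → σ ↾ ∁ ⁅ x ⁆ ≡ remove _≟_ x σ
  ↾∁⁅⁆≡remove σ x = filter-≐ (λ z → T? (lookup (∁ ⁅ x ⁆) z)) (λ z → _≢?_ _≟_ z x)
    ((λ {z} Tz → ∈∁⁅⁆⇒≢ (lookup⇒[]= z (∁ ⁅ x ⁆) (Equivalence.to T-≡ Tz))) ,
     (λ z≢x → Equivalence.from T-≡ ([]=⇒lookup (x∉p⇒x∈∁p (x≢y⇒x∉⁅y⁆ z≢x))))) σ

-- Families within Ulam distance k

module _ {n : ℕ} where

  UlamWithin-sym : ∀ {k} {α β : List (Fin n)} → UlamWithin k α β → UlamWithin k β α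
  UlamWithin-sym (A , ∣A∣≤k , α-A≡β-A) = A , ∣A∣≤k , sym α-A≡β-A

  UlamWithin-refl : ∀ {k} (α : List (Fin n)) → UlamWithin k α α
  UlamWithin-refl α = ∅ , ≤-trans (≤-reflexive (∣⊥∣≡0 n)) z≤n , refl

  UlamWithin0⇒≡ : ∀ {α β : List (Fin n)} → UlamWithin 0 α β → α ≡ β
  UlamWithin0⇒≡ {α} {β} (A , ∣A∣≤0 , α-A≡β-A) = trans (sym (nothing-deleted α)) (trans α-A≡β-A (nothing-deleted β))
    where
    nothing-deleted : ∀ σ → σ - A ≡ σ
    nothing-deleted σ =
      filter-all _ (All.tabulate (λ _ → subst (T ∘ not) (sym (∉⇒lookup (∣p∣≤0⇒∉ {p = A} ∣A∣≤0))) tt))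

  IsKFamily-lookup : ∀ {k ℱ α β} → IsKFamily k n ℱ → α ∈ ℱ → β ∈ ℱ → UlamWithin k α β
  IsKFamily-lookup {α = α} (_ , _ , close) α∈ β∈
    with AllPairs-lookup (λ {α′} {β′} → UlamWithin-sym {α = α′} {β′}) close α∈ β∈
  ... | inj₁ refl = UlamWithin-refl α
  ... | inj₂ α≈β = α≈β

  commonDeletion⇒IsKFamily : ∀ {k ℱ w} (A : Subset n) → All (IsPerm n) ℱ → Unique ℱ → ∣ A ∣ ≤ k →
    (∀ {σ} → σ ∈ ℱ → σ - A ≡ w) → IsKFamily k n ℱ
  commonDeletion⇒IsKFamily {ℱ = ℱ} A perms ℱ! ∣A∣≤k common =
    perms , ℱ! , AllPairs-tabulate ℱ (λ α∈ β∈ → A , ∣A∣≤k , trans (common α∈) (sym (common β∈)))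

  fIs-n! : ∀ {k} → Fin n → n ∸ 1 ≤ k → fIs k n (n !)
  fIs-n! {k} x n∸1≤k =
    (allPerms n , allPerms-family , length-allPerms {n}) , λ _ (perms , ℱ! , _) → length≤n! perms ℱ!
    where
    allPerms-family : IsKFamily k n (allPerms n)
    allPerms-family = commonDeletion⇒IsKFamily (∁ ⁅ x ⁆) (All.tabulate ∈-allPerms⁻) allPerms-Unique
      (≤-trans (≤-reflexive (trans (∣∁p∣≡n∸∣p∣ ⁅ x ⁆) (cong (n ∸_) (∣⁅x⁆∣≡1 x)))) n∸1≤k)
      (λ {σ} σ∈ → trans (-∁≡↾ σ ⁅ x ⁆) (↾-singleton (∈-allPerms⁻ σ∈) x))

  fIs-0 : fIs 0 n 1
  fIs-0 = (allFin n ∷ [] , (↭-refl ∷ [] , [] ∷ [] , [] ∷ []) , refl) , length≤1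
    where
    length≤1 : ∀ ℱ → IsKFamily 0 n ℱ → length ℱ ≤ 1
    length≤1 [] _ = z≤n
    length≤1 (_ ∷ []) _ = s≤s z≤n
    length≤1 (_ ∷ _ ∷ _) (_ , (α≢β ∷ _) ∷ _ , (α≈β ∷ _) ∷ _) = contradiction (UlamWithin0⇒≡ α≈β) α≢β

  reverseFree⇒length*2≤n! : ∀ {ℱ} → All (IsPerm n) ℱ → Unique ℱ →
    (∀ {α β} → α ∈ ℱ → β ∈ ℱ → α ≢ reverse β) → length ℱ * 2 ≤ n !
  reverseFree⇒length*2≤n! perms ℱ! reverseFree =
    ≤-trans (reverseFree⇒length*2≤! ℱ! perms reverseFree) (≤-reflexive (cong _! (length-tabulate {n = n} id)))

  SameOrder⇒≢reverse-perm : ∀ {α β x y} → IsPerm n β → x ≢ y → SameOrder α β x y → α ≢ reverse β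
  SameOrder⇒≢reverse-perm {x = x} {y} β↭ = SameOrder⇒≢reverse (IsPerm⇒Unique β↭) (IsPerm⇒∈ β↭ x) (IsPerm⇒∈ β↭ y)

  UlamWithin-n∸2⇒SameOrder : ∀ {α β} → 2 ≤ n → UlamWithin (n ∸ 2) α β → ∃₂ λ x y → x ≢ y × SameOrder α β x y
  UlamWithin-n∸2⇒SameOrder {α} {β} 2≤n (B , ∣B∣≤n∸2 , α-B≡β-B) with 2≤∣p∣⇒∈ (∁ B) 2≤∣∁B∣
    where
    open ≤-Reasoning
    2≤∣∁B∣ : 2 ≤ ∣ ∁ B ∣
    2≤∣∁B∣ = begin
      2            ≡⟨ m∸[m∸n]≡n 2≤n ⟨
      n ∸ (n ∸ 2)  ≤⟨ ∸-monoʳ-≤ n ∣B∣≤n∸2 ⟩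
      n ∸ ∣ B ∣    ≡⟨ ∣∁p∣≡n∸∣p∣ B ⟨
      ∣ ∁ B ∣      ∎
  ... | x , y , x≢y , x∈∁B , y∈∁B =
    x , y , x≢y , deletion⇒SameOrder {α = α} {β} α-B≡β-B (x∈∁p⇒x∉p x∈∁B) (x∈∁p⇒x∉p y∈∁B)

  IsKFamily-n∸2⇒length*2≤n! : ∀ {ℱ} → 2 ≤ n → IsKFamily (n ∸ 2) n ℱ → length ℱ * 2 ≤ n !
  IsKFamily-n∸2⇒length*2≤n! {ℱ} 2≤n ℱ-family@(perms , ℱ! , _) = reverseFree⇒length*2≤n! perms ℱ! reverseFree
    where
    reverseFree : ∀ {α β} → α ∈ ℱ → β ∈ ℱ → α ≢ reverse β
    reverseFree {α} {β} α∈ β∈ with UlamWithin-n∸2⇒SameOrder {α} {β} 2≤n (IsKFamily-lookup ℱ-family α∈ β∈)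
    ... | x , y , x≢y , α≈β = SameOrder⇒≢reverse-perm (All.lookup perms β∈) x≢y α≈β

  filter-allPerms-IsPerm : ∀ {P : List (Fin n) → Set} (P? : ∀ σ → Dec (P σ)) →
    All (IsPerm n) (filter P? (allPerms n))
  filter-allPerms-IsPerm P? = All.tabulate (∈-allPerms⁻ ∘ proj₁ ∘ ∈-filter⁻ P? {xs = allPerms n})

  filter-allPerms-Unique : ∀ {P : List (Fin n) → Set} (P? : ∀ σ → Dec (P σ)) → Unique (filter P? (allPerms n))
  filter-allPerms-Unique P? = Unique.filter⁺ P? allPerms-Unique

  constantPairOrder⇒length*2≤n! : ∀ {ℱ x y w} → x ≢ y → All (IsPerm n) ℱ → Unique ℱ →
    (∀ {σ} → σ ∈ ℱ → σ ↾ ⟦ x ∷ y ∷ [] ⟧ ≡ w) → length ℱ * 2 ≤ n !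
  constantPairOrder⇒length*2≤n! x≢y perms ℱ! constant = reverseFree⇒length*2≤n! perms ℱ!
    (λ α∈ β∈ → SameOrder⇒≢reverse-perm (All.lookup perms β∈) x≢y (trans (constant α∈) (sym (constant β∈))))

  module InOrder {x y : Fin n} (x≢y : x ≢ y) where

    private
      xy : List (Fin n)
      xy = x ∷ y ∷ []

    2≤∣⟦xy⟧∣ : 2 ≤ ∣ ⟦ xy ⟧ ∣
    2≤∣⟦xy⟧∣ = 2≤∣p∣ x≢y (∈⟦⟧⁺ xy (here refl)) (∈⟦⟧⁺ xy (there (here refl)))

    inOrder? : ∀ σ → Dec (σ ↾ ⟦ xy ⟧ ≡ xy)
    inOrder? σ = ≡-dec _≟_ (σ ↾ ⟦ xy ⟧) xy

    notInOrder? : ∀ σ → Dec (¬ σ ↾ ⟦ xy ⟧ ≡ xy)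
    notInOrder? σ = ¬? (inOrder? σ)

    ordered reversed : List (List (Fin n))
    ordered = filter inOrder? (allPerms n)
    reversed = filter notInOrder? (allPerms n)

    ordered-constant : ∀ {σ} → σ ∈ ordered → σ ↾ ⟦ xy ⟧ ≡ xy
    ordered-constant = proj₂ ∘ ∈-filter⁻ inOrder? {xs = allPerms n}

    reversed-constant : ∀ {σ} → σ ∈ reversed → σ ↾ ⟦ xy ⟧ ≡ y ∷ x ∷ []
    reversed-constant σ∈ with σ∈perms , ¬ordered ← ∈-filter⁻ notInOrder? {xs = allPerms n} σ∈ =
      fromInj₂ (λ inOrder → contradiction inOrder ¬ordered)
        (↾-pair (IsPerm⇒Unique σ↭) (IsPerm⇒∈ σ↭ x) (IsPerm⇒∈ σ↭ y) x≢y)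
      where
      σ↭ : IsPerm n _
      σ↭ = ∈-allPerms⁻ σ∈perms

    ordered-IsKFamily : IsKFamily (n ∸ 2) n ordered
    ordered-IsKFamily =
      commonDeletion⇒IsKFamily (∁ ⟦ xy ⟧) (filter-allPerms-IsPerm inOrder?) (filter-allPerms-Unique inOrder?)
        (≤-trans (≤-reflexive (∣∁p∣≡n∸∣p∣ ⟦ xy ⟧)) (∸-monoʳ-≤ n 2≤∣⟦xy⟧∣))
        (λ {σ} σ∈ → trans (-∁≡↾ σ ⟦ xy ⟧) (ordered-constant σ∈))

    -- Both halves are reverse-free, so each has at most n!/2 members, and together they exhaust Sₙ.
    length-ordered : length ordered ≡ n ! / 2
    length-ordered = begin
      length ordered                          ≡⟨ m*n/n≡m (length ordered) 2 ⟨
      length ordered * 2 / 2                  ≡⟨ cong (_/ 2) ordered*2≡ ⟩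
      (length ordered + length reversed) / 2  ≡⟨ cong (_/ 2) partition ⟩
      n ! / 2                                 ∎
      where
      open ≡-Reasoning
      partition : length ordered + length reversed ≡ n !
      partition = trans (length-filter-+-¬ inOrder? (allPerms n)) (length-allPerms {n})
      bound : ∀ {P : List (Fin n) → Set} {w} (P? : ∀ σ → Dec (P σ)) →
        (∀ {σ} → σ ∈ filter P? (allPerms n) → σ ↾ ⟦ xy ⟧ ≡ w) →
        length (filter P? (allPerms n)) * 2 ≤ length ordered + length reversed
      bound P? constant = subst (length (filter P? (allPerms n)) * 2 ≤_) (sym partition)
        (constantPairOrder⇒length*2≤n! x≢y (filter-allPerms-IsPerm P?) (filter-allPerms-Unique P?) constant)
      ordered*2≡ : length ordered * 2 ≡ length ordered + length reversed
      ordered*2≡ = m*2≤m+n⇒n*2≤m+n⇒m*2≡m+n (length ordered) (length reversed)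
        (bound inOrder? ordered-constant) (bound notInOrder? reversed-constant)

  fIs-n!/2 : ∀ {x y : Fin n} → x ≢ y → fIs (n ∸ 2) n (n ! / 2)
  fIs-n!/2 {x} {y} x≢y = (ordered , ordered-IsKFamily , length-ordered) , upper
    where
    open InOrder x≢y
    upper : ∀ ℱ → IsKFamily (n ∸ 2) n ℱ → length ℱ ≤ n ! / 2
    upper ℱ ℱ-family = subst (_≤ n ! / 2) (m*n/n≡m (length ℱ) 2)
      (/-monoˡ-≤ 2 (IsKFamily-n∸2⇒length*2≤n! (≤-trans 2≤∣⟦xy⟧∣ (∣p∣≤n ⟦ x ∷ y ∷ [] ⟧)) ℱ-family))

-- Intersecting sets of pairs

module StarOrTriangle {n : ℕ} {Edge : Fin n → Fin n → Set}
  (Edge? : ∀ x y → Dec (Edge x y))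
  (Edge-sym : ∀ {x y} → Edge x y → Edge y x)
  (Edge-irrefl : ∀ {x y} → Edge x y → x ≢ y)
  (Edge-meet : ∀ {x y u v} → Edge x y → Edge u v → x ≡ u ⊎ x ≡ v ⊎ y ≡ u ⊎ y ≡ v)
  where

  Star : Fin n → Set
  Star c = ∀ {x y} → Edge x y → x ≡ c ⊎ y ≡ c

  Triangle : Fin n → Fin n → Fin n → Set
  Triangle a b c = a ≢ b × b ≢ c × a ≢ c × (∀ {x y} → Edge x y → x ∈ a ∷ b ∷ c ∷ [])

  meet-other : ∀ {x y u v} → Edge x y → Edge u v → x ≢ u → x ≢ v → y ≡ u ⊎ y ≡ v
  meet-other xy uv x≢u x≢v with Edge-meet xy uv
  ... | inj₁ x≡u = contradiction x≡u x≢u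
  ... | inj₂ (inj₁ x≡v) = contradiction x≡v x≢v
  ... | inj₂ (inj₂ y≡u⊎y≡v) = y≡u⊎y≡v

  star-or-avoidingEdge : ∀ c → Star c ⊎ ∃₂ λ x y → Edge x y × x ≢ c × y ≢ c
  star-or-avoidingEdge c with all? (λ x → all? (λ y → ¬? (Edge? x y) ⊎-dec (x ≟ c ⊎-dec y ≟ c)))
  ... | yes covered = inj₁ λ {x} {y} xy → star (covered x y) xy
    where
    star : ∀ {x y} → ¬ Edge x y ⊎ (x ≡ c ⊎ y ≡ c) → Edge x y → x ≡ c ⊎ y ≡ c
    star (inj₁ ¬xy) xy = contradiction xy ¬xy
    star (inj₂ x≡c⊎y≡c) _ = x≡c⊎y≡c
  ... | no ¬covered with x , ¬∀y ← ¬∀⟶∃¬ n _ (λ x → all? (λ y → ¬? (Edge? x y) ⊎-dec (x ≟ c ⊎-dec y ≟ c))) ¬covered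
                    with y , uncovered ← ¬∀⟶∃¬ n _ (λ y → ¬? (Edge? x y) ⊎-dec (x ≟ c ⊎-dec y ≟ c)) ¬∀y =
    inj₂ (x , y , decidable-stable (Edge? x y) (uncovered ∘ inj₁) ,
          uncovered ∘ inj₂ ∘ inj₁ , uncovered ∘ inj₂ ∘ inj₂)

  touches : ∀ {x y u v} → Edge x y → Edge u v → x ≢ v → y ≢ v → x ≡ u ⊎ y ≡ u
  touches xy uv x≢v y≢v with Edge-meet xy uv
  ... | inj₁ x≡u = inj₁ x≡u
  ... | inj₂ (inj₁ x≡v) = contradiction x≡v x≢v
  ... | inj₂ (inj₂ (inj₁ y≡u)) = inj₂ y≡u
  ... | inj₂ (inj₂ (inj₂ y≡v)) = contradiction y≡v y≢v

  -- If b is not the centre of a star, an edge avoiding b meets both ab and bd, so it is ad; every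
  -- edge then meets all three sides of the triangle abd and therefore lies inside it.
  path⇒star-or-triangle : ∀ {a b d} → Edge a b → Edge b d → d ≢ a → (∃ Star) ⊎ (∃₂ λ a b → ∃ (Triangle a b))
  path⇒star-or-triangle {a} {b} {d} ab bd d≢a with star-or-avoidingEdge b
  ... | inj₁ star = inj₁ (b , star)
  ... | inj₂ (e , f , ef , e≢b , f≢b) = inj₂ (a , b , d , a≢b , b≢d , a≢d , triangle)
    where
    a≢b : a ≢ b
    a≢b = Edge-irrefl ab
    b≢d : b ≢ d
    b≢d = Edge-irrefl bd
    a≢d : a ≢ d
    a≢d a≡d = d≢a (sym a≡d)

    ad : Edge a d
    ad with touches ef ab e≢b f≢b | touches ef (Edge-sym bd) e≢b f≢b
    ... | inj₁ e≡a | inj₁ e≡d = contradiction (trans (sym e≡a) e≡d) a≢d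
    ... | inj₁ e≡a | inj₂ f≡d = subst₂ Edge e≡a f≡d ef
    ... | inj₂ f≡a | inj₁ e≡d = Edge-sym (subst₂ Edge e≡d f≡a ef)
    ... | inj₂ f≡a | inj₂ f≡d = contradiction (trans (sym f≡a) f≡d) a≢d

    triangle : ∀ {x y} → Edge x y → x ∈ a ∷ b ∷ d ∷ []
    triangle {x} {y} xy with x ≟ a | x ≟ b | x ≟ d
    ... | yes x≡a | _ | _ = here x≡a
    ... | no _ | yes x≡b | _ = there (here x≡b)
    ... | no _ | no _ | yes x≡d = there (there (here x≡d))
    ... | no x≢a | no x≢b | no x≢d =
      ⊥-elim (nowhere (meet-other xy ab x≢a x≢b) (meet-other xy bd x≢b x≢d) (meet-other xy ad x≢a x≢d))
      where
      nowhere : y ≡ a ⊎ y ≡ b → y ≡ b ⊎ y ≡ d → y ≡ a ⊎ y ≡ d → ⊥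
      nowhere (inj₁ y≡a) (inj₁ y≡b) _ = a≢b (trans (sym y≡a) y≡b)
      nowhere (inj₁ y≡a) (inj₂ y≡d) _ = a≢d (trans (sym y≡a) y≡d)
      nowhere (inj₂ y≡b) _ (inj₁ y≡a) = a≢b (trans (sym y≡a) y≡b)
      nowhere (inj₂ y≡b) _ (inj₂ y≡d) = b≢d (trans (sym y≡b) y≡d)

  star-or-triangle : Fin n → (∃ Star) ⊎ (∃₂ λ a b → ∃ (Triangle a b))
  star-or-triangle x₀ with star-or-avoidingEdge x₀
  ... | inj₁ star = inj₁ (x₀ , star)
  ... | inj₂ (a , b , ab , _ , _) with star-or-avoidingEdge a
  ...   | inj₁ star = inj₁ (a , star)
  ...   | inj₂ (c , d , cd , c≢a , d≢a) with meet-other ab cd (c≢a ∘ sym) (d≢a ∘ sym)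
  ...     | inj₁ b≡c = path⇒star-or-triangle ab (subst (λ z → Edge z d) (sym b≡c) cd) d≢a
  ...     | inj₂ b≡d = path⇒star-or-triangle ab (subst (λ z → Edge z c) (sym b≡d) (Edge-sym cd)) c≢a

-- Families within Ulam distance one

module _ {n : ℕ} where

  oneMove-SameOrder : ∀ {β γ : List (Fin n)} {x y u v} → UlamWithin 1 β γ →
    x ≢ u → x ≢ v → y ≢ u → y ≢ v → SameOrder β γ x y ⊎ SameOrder β γ u v
  oneMove-SameOrder {β} {γ} {x} {y} {u} {v} (A , ∣A∣≤1 , β-A≡γ-A) x≢u x≢v y≢u y≢v with u ∈ₛ? A | v ∈ₛ? A
  ... | yes u∈A | _ = inj₁ (deletion⇒SameOrder {α = β} {γ} β-A≡γ-A (∣p∣≤1⇒∉ ∣A∣≤1 u∈A x≢u) (∣p∣≤1⇒∉ ∣A∣≤1 u∈A y≢u))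
  ... | no _ | yes v∈A =
    inj₁ (deletion⇒SameOrder {α = β} {γ} β-A≡γ-A (∣p∣≤1⇒∉ ∣A∣≤1 v∈A x≢v) (∣p∣≤1⇒∉ ∣A∣≤1 v∈A y≢v))
  ... | no u∉A | no v∉A = inj₂ (deletion⇒SameOrder {α = β} {γ} β-A≡γ-A u∉A v∉A)

  oneMove-triangle : ∀ {β γ : List (Fin n)} {a b c} → UlamWithin 1 β γ → a ≢ b → b ≢ c → a ≢ c →
    ∃₂ λ s t → s ≢ t × s ∈ a ∷ b ∷ c ∷ [] × t ∈ a ∷ b ∷ c ∷ [] × SameOrder β γ s t
  oneMove-triangle {β} {γ} {a} {b} {c} (A , ∣A∣≤1 , β-A≡γ-A) a≢b b≢c a≢c with a ∈ₛ? A | b ∈ₛ? A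
  ... | yes a∈A | _ = b , c , b≢c , there (here refl) , there (there (here refl)) ,
    deletion⇒SameOrder {α = β} {γ} β-A≡γ-A (∣p∣≤1⇒∉ ∣A∣≤1 a∈A (a≢b ∘ sym)) (∣p∣≤1⇒∉ ∣A∣≤1 a∈A (a≢c ∘ sym))
  ... | no a∉A | yes b∈A = a , c , a≢c , here refl , there (there (here refl)) ,
    deletion⇒SameOrder {α = β} {γ} β-A≡γ-A a∉A (∣p∣≤1⇒∉ ∣A∣≤1 b∈A (b≢c ∘ sym))
  ... | no a∉A | no b∉A = a , b , a≢b , here refl , there (here refl) ,
    deletion⇒SameOrder {α = β} {γ} β-A≡γ-A a∉A b∉A

module OneMoveFamily {n : ℕ} {α₀ : List (Fin n)} {ℱ : List (List (Fin n))}
  (family : IsKFamily 1 n (α₀ ∷ ℱ)) where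

  open import Data.List.Membership.DecPropositional (_≟_ {n}) using (_∈?_)

  private
    F : List (List (Fin n))
    F = α₀ ∷ ℱ
    perms : All (IsPerm n) F
    perms = proj₁ family
    F! : Unique F
    F! = proj₁ (proj₂ family)

  Settled : Fin n → Fin n → Set
  Settled x y = All (λ β → SameOrder α₀ β x y) F

  settled? : ∀ x y → Dec (Settled x y)
  settled? x y = All.all? (λ β → ≡-dec _≟_ (α₀ ↾ ⟦ x ∷ y ∷ [] ⟧) (β ↾ ⟦ x ∷ y ∷ [] ⟧)) F

  Settled⇒SameOrder : ∀ {x y β γ} → Settled x y → β ∈ F → γ ∈ F → SameOrder β γ x y
  Settled⇒SameOrder settled β∈ γ∈ = trans (sym (All.lookup settled β∈)) (All.lookup settled γ∈)

  unsettled-witness : ∀ {x y} → ¬ Settled x y → ∃ λ β → β ∈ F × ¬ SameOrder α₀ β x y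
  unsettled-witness {x} {y} = find ∘ ¬All⇒Any¬ (λ β → ≡-dec _≟_ (α₀ ↾ ⟦ x ∷ y ∷ [] ⟧) (β ↾ ⟦ x ∷ y ∷ [] ⟧)) F

  -- A single deletion spares one of two disjoint pairs; comparing α₀, β and γ pairwise then forces
  -- one of the witnesses to agree with α₀ after all.
  disjoint-unsettled : ∀ {x y u v} → x ≢ u → x ≢ v → y ≢ u → y ≢ v → ¬ Settled x y → ¬ Settled u v → ⊥
  disjoint-unsettled {x} {y} {u} {v} x≢u x≢v y≢u y≢v ¬xy ¬uv
    with β , β∈ , β≉xy ← unsettled-witness {x} {y} ¬xy | γ , γ∈ , γ≉uv ← unsettled-witness {u} {v} ¬uv
    with oneMove (here refl) β∈ | oneMove (here refl) γ∈ | oneMove β∈ γ∈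
    where
    oneMove : ∀ {β γ} → β ∈ F → γ ∈ F → SameOrder β γ x y ⊎ SameOrder β γ u v
    oneMove {β} {γ} β∈ γ∈ = oneMove-SameOrder {β = β} {γ} (IsKFamily-lookup family β∈ γ∈) x≢u x≢v y≢u y≢v
  ... | inj₁ α₀β-xy | _ | _ = β≉xy α₀β-xy
  ... | _ | inj₂ α₀γ-uv | _ = γ≉uv α₀γ-uv
  ... | inj₂ _ | inj₁ α₀γ-xy | inj₁ βγ-xy = β≉xy (trans α₀γ-xy (sym βγ-xy))
  ... | inj₂ α₀β-uv | inj₁ _ | inj₂ βγ-uv = γ≉uv (trans α₀β-uv βγ-uv)

  Settled-swap : ∀ {x y} → Settled x y → Settled y x
  Settled-swap {x} {y} = All.map (λ {β} → SameOrder-swap {α = α₀} {β} {x} {y})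

  Unsettled : Fin n → Fin n → Set
  Unsettled x y = x ≢ y × ¬ Settled x y

  unsettled? : ∀ x y → Dec (Unsettled x y)
  unsettled? x y = ¬? (x ≟ y) ×-dec ¬? (settled? x y)

  unsettled-sym : ∀ {x y} → Unsettled x y → Unsettled y x
  unsettled-sym {x} {y} (x≢y , ¬xy) = x≢y ∘ sym , ¬xy ∘ Settled-swap {y} {x}

  unsettled-meet : ∀ {x y u v} → Unsettled x y → Unsettled u v → x ≡ u ⊎ x ≡ v ⊎ y ≡ u ⊎ y ≡ v
  unsettled-meet {x} {y} {u} {v} (_ , ¬xy) (_ , ¬uv) with x ≟ u | x ≟ v | y ≟ u | y ≟ v
  ... | yes x≡u | _ | _ | _ = inj₁ x≡u
  ... | no _ | yes x≡v | _ | _ = inj₂ (inj₁ x≡v)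
  ... | no _ | no _ | yes y≡u | _ = inj₂ (inj₂ (inj₁ y≡u))
  ... | no _ | no _ | no _ | yes y≡v = inj₂ (inj₂ (inj₂ y≡v))
  ... | no x≢u | no x≢v | no y≢u | no y≢v = ⊥-elim (disjoint-unsettled x≢u x≢v y≢u y≢v ¬xy ¬uv)

  open StarOrTriangle unsettled? unsettled-sym proj₁ unsettled-meet

  settled-off : ∀ {x y} → x ≢ y → ¬ Unsettled x y → Settled x y
  settled-off {x} {y} x≢y ¬unsettled = decidable-stable (settled? x y) (λ ¬settled → ¬unsettled (x≢y , ¬settled))

  star⇒agree-off-centre : ∀ {c β} → Star c → β ∈ F → β ↾ ∁ ⁅ c ⁆ ≡ α₀ ↾ ∁ ⁅ c ⁆
  star⇒agree-off-centre {c} {β} star β∈ =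
    ≡-byPairOrders (↾-Unique (∁ ⁅ c ⁆) (IsPerm⇒Unique β↭))
      (filter-↭ (λ z → T? (lookup (∁ ⁅ c ⁆) z)) (↭-trans β↭ (↭-sym (All.lookup perms (here refl))))) orders
    where
    β↭ : IsPerm n β
    β↭ = All.lookup perms β∈
    orders : ∀ {a b} → a ∈ β ↾ ∁ ⁅ c ⁆ → b ∈ β ↾ ∁ ⁅ c ⁆ → a ≢ b → SameOrder (β ↾ ∁ ⁅ c ⁆) (α₀ ↾ ∁ ⁅ c ⁆) a b
    orders {a} {b} a∈ b∈ a≢b = begin
      β ↾ ∁ ⁅ c ⁆ ↾ ⟦ a ∷ b ∷ [] ⟧   ≡⟨ ↾-↾ ab⊆ β ⟩
      β ↾ ⟦ a ∷ b ∷ [] ⟧             ≡⟨ Settled⇒SameOrder {a} {b} (settled-off a≢b off-c) β∈ (here refl) ⟩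
      α₀ ↾ ⟦ a ∷ b ∷ [] ⟧            ≡⟨ ↾-↾ ab⊆ α₀ ⟨
      α₀ ↾ ∁ ⁅ c ⁆ ↾ ⟦ a ∷ b ∷ [] ⟧  ∎
      where
      open ≡-Reasoning
      a≢c : a ≢ c
      a≢c = ∈∁⁅⁆⇒≢ (proj₂ (∈-↾⁻ β a∈))
      b≢c : b ≢ c
      b≢c = ∈∁⁅⁆⇒≢ (proj₂ (∈-↾⁻ β b∈))
      ab⊆ : ⟦ a ∷ b ∷ [] ⟧ ⊆ₛ ∁ ⁅ c ⁆
      ab⊆ = ⟦⟧⊆∁⁅⁆ {xs = a ∷ b ∷ []} {c} λ { (here refl) → a≢c ; (there (here refl)) → b≢c }
      off-c : ¬ Unsettled a b
      off-c ab = Sum.[ a≢c , b≢c ] (star ab)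

  star⇒length≤n : ∀ {c} → Star c → length F ≤ n
  star⇒length≤n {c} star = begin
    length F                  ≤⟨ Unique⇒length≤ F! F⊆insertions ⟩
    length (insertions c w₀)  ≡⟨ length-insertions c w₀ ⟩
    suc (length w₀)           ≡⟨ ↭-length (∈-insertions⇒↭ w₀ (∈-insertions-residue (here refl))) ⟨
    length α₀                 ≡⟨ IsPerm⇒length (All.lookup perms (here refl)) ⟩
    n                         ∎
    where
    open ≤-Reasoning
    w₀ : List (Fin n)
    w₀ = remove _≟_ c α₀
    ∈-insertions-residue : ∀ {β} → β ∈ F → β ∈ insertions c (remove _≟_ c β)
    ∈-insertions-residue {β} β∈ = ∈-insertions-remove _≟_ (IsPerm⇒Unique β↭) (IsPerm⇒∈ β↭ c)
      where
      β↭ : IsPerm n β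
      β↭ = All.lookup perms β∈
    F⊆insertions : ∀ {β} → β ∈ F → β ∈ insertions c w₀
    F⊆insertions {β} β∈ = subst (λ w → β ∈ insertions c w) residue≡ (∈-insertions-residue β∈)
      where
      residue≡ : remove _≟_ c β ≡ w₀
      residue≡ = trans (sym (↾∁⁅⁆≡remove β c)) (trans (star⇒agree-off-centre star β∈) (↾∁⁅⁆≡remove α₀ c))

  module _ {a b c} (triangle : Triangle a b c) where

    private
      abc : List (Fin n)
      abc = a ∷ b ∷ c ∷ []
      Δ : Subset n
      Δ = ⟦ abc ⟧
      a≢b : a ≢ b
      a≢b = proj₁ triangle
      b≢c : b ≢ c
      b≢c = proj₁ (proj₂ triangle)
      a≢c : a ≢ c
      a≢c = proj₁ (proj₂ (proj₂ triangle))
      abc! : Unique abc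
      abc! = (a≢b ∷ a≢c ∷ []) ∷ (b≢c ∷ []) ∷ [] ∷ []

    pair⊆triangle : ∀ {x y} → x ∈ abc → y ∈ abc → ⟦ x ∷ y ∷ [] ⟧ ⊆ₛ Δ
    pair⊆triangle {x} {y} x∈ y∈ = ⟦⟧-⊆ {xs = x ∷ y ∷ []} {abc} λ { (here refl) → x∈ ; (there (here refl)) → y∈ }

    restriction-injective : ∀ {β γ} → β ∈ F → γ ∈ F → β ↾ Δ ≡ γ ↾ Δ → β ≡ γ
    restriction-injective {β} {γ} β∈ γ∈ β↾≡γ↾ =
      ≡-byPairOrders (IsPerm⇒Unique β↭) (↭-trans β↭ (↭-sym (All.lookup perms γ∈))) orders
      where
      β↭ : IsPerm n β
      β↭ = All.lookup perms β∈
      settled-outside : ∀ {x y} → x ≢ y → x ∉ abc → Settled x y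
      settled-outside x≢y x∉ = settled-off x≢y (x∉ ∘ proj₂ (proj₂ (proj₂ triangle)))
      orders : ∀ {x y} → x ∈ β → y ∈ β → x ≢ y → SameOrder β γ x y
      orders {x} {y} _ _ x≢y with x ∈? abc | y ∈? abc
      ... | no x∉ | _ = Settled⇒SameOrder {x} {y} (settled-outside x≢y x∉) β∈ γ∈
      ... | yes _ | no y∉ =
        SameOrder-swap {α = β} {γ} {y} {x} (Settled⇒SameOrder {y} {x} (settled-outside (x≢y ∘ sym) y∉) β∈ γ∈)
      ... | yes x∈ | yes y∈ = begin
        β ↾ ⟦ x ∷ y ∷ [] ⟧      ≡⟨ ↾-↾ (pair⊆triangle x∈ y∈) β ⟨
        β ↾ Δ ↾ ⟦ x ∷ y ∷ [] ⟧  ≡⟨ cong (_↾ ⟦ x ∷ y ∷ [] ⟧) β↾≡γ↾ ⟩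
        γ ↾ Δ ↾ ⟦ x ∷ y ∷ [] ⟧  ≡⟨ ↾-↾ (pair⊆triangle x∈ y∈) γ ⟩
        γ ↾ ⟦ x ∷ y ∷ [] ⟧      ∎
        where open ≡-Reasoning

    restriction-reverseFree : ∀ {β γ} → β ∈ F → γ ∈ F → β ↾ Δ ≢ reverse (γ ↾ Δ)
    restriction-reverseFree {β} {γ} β∈ γ∈
      with s , t , s≢t , s∈ , t∈ , βγ-st ←
             oneMove-triangle {β = β} {γ} (IsKFamily-lookup family β∈ γ∈) a≢b b≢c a≢c =
      SameOrder⇒≢reverse (↾-Unique Δ (IsPerm⇒Unique γ↭)) (∈-↾⟦⟧⁺ abc γ↭ s∈) (∈-↾⟦⟧⁺ abc γ↭ t∈) s≢t
        (trans (↾-↾ (pair⊆triangle s∈ t∈) β) (trans βγ-st (sym (↾-↾ (pair⊆triangle s∈ t∈) γ))))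
      where
      γ↭ : IsPerm n γ
      γ↭ = All.lookup perms γ∈

    triangle⇒length≤n : length F ≤ n
    triangle⇒length≤n = begin
      length F           ≤⟨ *-cancelʳ-≤ (length F) 3 2 length*2≤6 ⟩
      length abc        ≤⟨ Unique⇒length≤ abc! (λ {z} _ → ∈-allFin z) ⟩
      length (allFin n)  ≡⟨ length-tabulate id ⟩
      n                  ∎
      where
      open ≤-Reasoning
      w₀ : List (Fin n)
      w₀ = allFin n ↾ Δ
      length-w₀ : length w₀ ≡ 3
      length-w₀ = ≤-antisym (Unique⇒length≤ (↾-Unique Δ (Unique.allFin⁺ n)) (∈-↾⟦⟧⁻ (allFin n) {abc}))
                            (Unique⇒length≤ abc! (∈-↾⟦⟧⁺ abc ↭-refl))
      restricted : List (List (Fin n))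
      restricted = map (_↾ Δ) F
      restricted-perms : All (_↭ w₀) restricted
      restricted-perms = All.tabulate λ σ∈ → case ∈-map⁻ (_↾ Δ) σ∈ of λ
        { (β , β∈ , refl) → filter-↭ (λ z → T? (lookup Δ z)) (All.lookup perms β∈) }
      restricted-reverseFree : ∀ {σ τ} → σ ∈ restricted → τ ∈ restricted → σ ≢ reverse τ
      restricted-reverseFree σ∈ τ∈ with ∈-map⁻ (_↾ Δ) σ∈ | ∈-map⁻ (_↾ Δ) τ∈
      ... | β , β∈ , refl | γ , γ∈ , refl = restriction-reverseFree β∈ γ∈
      length*2≤6 : length F * 2 ≤ 3 * 2
      length*2≤6 = begin
        length F * 2           ≡⟨ cong (_* 2) (length-map (_↾ Δ) F) ⟨
        length restricted * 2  ≤⟨ reverseFree⇒length*2≤! (Unique-map⁺-injectiveOn (_↾ Δ) F! restriction-injective)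
                                     restricted-perms restricted-reverseFree ⟩
        length w₀ !            ≡⟨ cong _! length-w₀ ⟩
        3 * 2                  ∎

  length≤n : Fin n → length F ≤ n
  length≤n x₀ with star-or-triangle x₀
  ... | inj₁ (_ , star) = star⇒length≤n star
  ... | inj₂ (_ , _ , _ , triangle) = triangle⇒length≤n triangle

module _ {n : ℕ} where

  fIs-1 : Fin n → fIs 1 n n
  fIs-1 x = (insertions x w , family , length-family) , upper
    where
    w : List (Fin n)
    w = remove _≟_ x (allFin n)
    x∉w : x ∉ w
    x∉w x∈w = proj₂ (∈-filter⁻ (λ z → _≢?_ _≟_ z x) {xs = allFin n} x∈w) refl
    allFin↭ : allFin n ↭ x ∷ w
    allFin↭ = ∈-insertions⇒↭ w (∈-insertions-remove _≟_ (Unique.allFin⁺ n) (∈-allFin x))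
    family : IsKFamily 1 n (insertions x w)
    family = commonDeletion⇒IsKFamily ⁅ x ⁆
      (All.tabulate (λ σ∈ → ↭-trans (∈-insertions⇒↭ w σ∈) (↭-sym allFin↭)))
      (insertions-Unique w x∉w) (≤-reflexive (∣⁅x⁆∣≡1 x))
      (λ {σ} σ∈ → trans (-≡↾∁ σ ⁅ x ⁆) (trans (↾∁⁅⁆≡remove σ x) (remove-insertions _≟_ w x∉w σ∈)))
    length-family : length (insertions x w) ≡ n
    length-family = trans (length-insertions x w) (trans (sym (↭-length allFin↭)) (length-tabulate id))
    upper : ∀ ℱ → IsKFamily 1 n ℱ → length ℱ ≤ n
    upper [] _ = z≤n
    upper (_ ∷ _) ℱ-family = OneMoveFamily.length≤n ℱ-family x

proposition6 : (n : ℕ) → 1 ≤ n →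
    (fIs n n (n !) × fIs (n ∸ 1) n (n !) × fIs 0 n 1)
    × (2 ≤ n → fIs (n ∸ 2) n (n ! / 2))
    × fIs 1 n n
proposition6 (suc m) _ = (fIs-n! zero (m∸n≤m (suc m) 1) , fIs-n! zero ≤-refl , fIs-0) , fIs-n∸2 , fIs-1 zero
  where
  fIs-n∸2 : 2 ≤ suc m → fIs (suc m ∸ 2) (suc m) (suc m ! / 2)
  fIs-n∸2 (s≤s (s≤s _)) = fIs-n!/2 {x = zero} {suc zero} (λ ())
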